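{- Let $\Phi$ be the fixed point beginning with $0$ of the morphism $0\mapsto 00101$, $1\mapsto 11011$. For each integer $C\ge4$, let $N_C=132\cdot 5^{C-4}$. Then for all $n\ge N_C$: (1) $z_M(n)\ge \frac{n}{3}+C$, and (2) $z_m(n)\le \frac{n}{3}-C$.
   Context: For $n\ge1$, $z_M(n)$ (resp. $z_m(n)$) denotes the maximum (resp. minimum) number of occurrences of the letter $0$ among all factors of length $n$ of $\Phi$. -}

module Defs where

open import Data.Nat using (ℕ; zero; suc; _+_; _*_; _/_; _%_; _<_)
open import Data.Fin using (Fin; zero; suc)
open import Data.Bool using (Bool; true; false; if_then_else_)

-- Letters of the binary alphabet: false = 0, true = 1.
-- The morphism σ : 0 ↦ 00101, 1 ↦ 11011, given letterwise:
-- σ a k = k-th letter (0-indexed, k < 5) of σ(a).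
σ : Bool → ℕ → Bool
σ false 0 = false
σ false 1 = false
σ false 2 = true
σ false 3 = false
σ false _ = true
σ true  0 = true
σ true  1 = true
σ true  2 = false
σ true  3 = true
σ true  _ = true

-- Φ, the fixed point of σ beginning with 0:  Φ(0) = 0 and
-- Φ(5q + r) = σ(Φ(q))[r]  for 0 ≤ r < 5.
-- Computed with fuel; fuel ≥ i suffices since i / 5 < i for i > 0.
Φ-aux : ℕ → ℕ → Bool
Φ-aux zero    i = false
Φ-aux (suc f) zero = false
Φ-aux (suc f) i@(suc _) = σ (Φ-aux f (i / 5)) (i % 5)

Φ : ℕ → Bool
Φ i = Φ-aux i i

zeros : ℕ → ℕ → ℕ
zeros i zero    = 0
zeros i (suc n) = (if Φ i then 0 else 1) + zeros (suc i) n

-- z_M(n) ≥ b  (max over all factors of length n of number of 0s is ≥ b;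
-- the max exists since the counts are bounded by n)
-- z_m(n) ≤ b  likewise.
open import Data.Product using (∃)
open import Data.Nat using (_≤_)

-- "z_M(n) ≥ n/3 + C", multiplied by 3 (exact over ℕ): some factor of
-- length n has at least n/3 + C zeros.
zM≥n/3+ : ℕ → ℕ → Set
zM≥n/3+ n C = ∃ λ i → n + 3 * C ≤ 3 * zeros i n

zm≤n/3- : ℕ → ℕ → Set
zm≤n/3- n C = ∃ λ i → 3 * zeros i n + 3 * C ≤ n

module Submission where

-- Idea.  σ(0) has three zeros and σ(1) has one, so the image under σ
-- of a factor of length m with z zeros is a factor of length 5m
-- (starting at a multiple of 5) with exactly 2z + m zeros.
-- Writing n = 5m + r with r < 5, a factor of length n/5 whose number of
-- zeros deviates from a third of its length by C (scaled by 3) therefore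
-- yields a factor of length n deviating by C + 1, as long as C is large
-- enough (C ≥ 3 above the mean, C ≥ 4 below it) to absorb the r extra
-- letters.  Since each such lift multiplies the length by 5, the bound
-- N_C = 132·5^(C−4) follows by induction on C − 4 from the case C = 4.
-- That base case comes from finitely many lengths checked by
-- computation (with explicit witness positions), propagated to all
-- larger lengths by the same lifting lemma ("self-similar induction").

open import Defs
open import Data.Nat
open import Data.Nat.Properties
open import Data.Nat.DivMod
open import Data.Nat.Divisibility using (divides)
open import Data.Nat.Induction using (<-rec)
open import Data.Nat.Tactic.RingSolver using (solve-∀)
open import Data.Bool using (Bool; true; false; if_then_else_; T; _∧_)
open import Data.Bool.Properties using (T-∧)
open import Data.Empty using (⊥-elim)
open import Function.Bundles using (Equivalence)
open import Data.Product using (_×_; _,_; ∃; map; map₂)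
open import Data.Sum using (inj₁; inj₂)
open import Data.List using (List; []; _∷_; length; replicate)
open import Data.Unit using (tt)
open import Relation.Binary.PropositionalEquality
open import Relation.Nullary using (yes; no)

suc/5≤ : ∀ j → suc j / 5 ≤ j
suc/5≤ j = <⇒≤pred (m/n<m (suc j) 5 (s≤s (s≤s z≤n)))

≤-/5 : ∀ a n → a * 5 ≤ n → a ≤ n / 5
≤-/5 a n h = subst (_≤ n / 5) (m*n/n≡m a 5) (/-monoˡ-≤ 5 h)

Φ-aux-fuel : ∀ f g j → j ≤ f → j ≤ g → Φ-aux f j ≡ Φ-aux g j
Φ-aux-fuel zero    zero    zero _ _ = refl
Φ-aux-fuel zero    (suc g) zero _ _ = refl
Φ-aux-fuel (suc f) zero    zero _ _ = refl
Φ-aux-fuel (suc f) (suc g) zero _ _ = refl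
Φ-aux-fuel (suc f) (suc g) (suc j) (s≤s j≤f) (s≤s j≤g) =
  cong (λ b → σ b (suc j % 5))
       (Φ-aux-fuel f g (suc j / 5) (≤-trans (suc/5≤ j) j≤f) (≤-trans (suc/5≤ j) j≤g))

Φ-unfold : ∀ j → Φ j ≡ σ (Φ (j / 5)) (j % 5)
Φ-unfold zero    = refl
Φ-unfold (suc j) =
  cong (λ b → σ b (suc j % 5)) (Φ-aux-fuel j (suc j / 5) (suc j / 5) (suc/5≤ j) ≤-refl)

Φ-σ : ∀ i r → r < 5 → Φ (r + i * 5) ≡ σ (Φ i) r
Φ-σ i r r<5 = trans (Φ-unfold (r + i * 5)) (cong₂ σ (cong Φ quotient) remainder)
  where
  quotient : (r + i * 5) / 5 ≡ i
  quotient = trans (+-distrib-/-∣ʳ r (divides i refl))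
                   (cong₂ _+_ (m<n⇒m/n≡0 r<5) (m*n/n≡m i 5))
  remainder : (r + i * 5) % 5 ≡ r
  remainder = trans ([m+kn]%n≡m%n r i 5) (m<n⇒m%n≡m r<5)

zero-at : ℕ → ℕ
zero-at i = if Φ i then 0 else 1

zeros-++ : ∀ i a b → zeros i (a + b) ≡ zeros i a + zeros (a + i) b
zeros-++ i zero    b = refl
zeros-++ i (suc a) b rewrite zeros-++ (suc i) a b | +-suc a i =
  sym (+-assoc (zero-at i) (zeros (suc i) a) (zeros (suc (a + i)) b))

zeros≤length : ∀ i r → zeros i r ≤ r
zeros≤length i zero    = z≤n
zeros≤length i (suc r) with Φ i
... | true  = m≤n⇒m≤1+n (zeros≤length (suc i) r)
... | false = s≤s (zeros≤length (suc i) r)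

-- σ(0) has 3 zeros and σ(1) has 1: in both cases 2·[letter is 0] + 1.
zeros-block : ∀ i → zeros (i * 5) 5 ≡ 2 * zero-at i + 1
zeros-block i
  rewrite Φ-σ i 0 (s≤s z≤n) | Φ-σ i 1 (s≤s (s≤s z≤n))
        | Φ-σ i 2 (s≤s (s≤s (s≤s z≤n))) | Φ-σ i 3 (s≤s (s≤s (s≤s (s≤s z≤n))))
        | Φ-σ i 4 (s≤s (s≤s (s≤s (s≤s (s≤s z≤n))))) with Φ i
... | true  = refl
... | false = refl

zeros-σ : ∀ i m → zeros (i * 5) (m * 5) ≡ 2 * zeros i m + m
zeros-σ i zero    = refl
zeros-σ i (suc m) = begin
  zeros (i * 5) (5 + m * 5)                    ≡⟨ zeros-++ (i * 5) 5 (m * 5) ⟩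
  zeros (i * 5) 5 + zeros (suc i * 5) (m * 5)  ≡⟨ cong₂ _+_ (zeros-block i) (zeros-σ (suc i) m) ⟩
  (2 * zero-at i + 1) + (2 * z + m)            ≡⟨ regroup (zero-at i) z m ⟩
  2 * (zero-at i + z) + suc m                  ∎
  where
  open ≡-Reasoning
  z : ℕ
  z = zeros (suc i) m
  regroup : ∀ b z m → (2 * b + 1) + (2 * z + m) ≡ 2 * (b + z) + suc m
  regroup = solve-∀

zeros-σ-lower : ∀ i m r → 2 * zeros i m + m ≤ zeros (i * 5) (m * 5 + r)
zeros-σ-lower i m r = begin
  2 * zeros i m + m                 ≤⟨ m≤m+n _ _ ⟩
  2 * zeros i m + m + extra         ≡⟨ cong (_+ extra) (zeros-σ i m) ⟨
  zeros (i * 5) (m * 5) + extra     ≡⟨ zeros-++ (i * 5) (m * 5) r ⟨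
  zeros (i * 5) (m * 5 + r)         ∎
  where
  open ≤-Reasoning
  extra : ℕ
  extra = zeros (m * 5 + i * 5) r

zeros-σ-upper : ∀ i m r → zeros (i * 5) (m * 5 + r) ≤ 2 * zeros i m + m + r
zeros-σ-upper i m r = begin
  zeros (i * 5) (m * 5 + r)         ≡⟨ zeros-++ (i * 5) (m * 5) r ⟩
  zeros (i * 5) (m * 5) + extra     ≡⟨ cong (_+ extra) (zeros-σ i m) ⟩
  2 * zeros i m + m + extra         ≤⟨ +-monoʳ-≤ (2 * zeros i m + m) (zeros≤length _ r) ⟩
  2 * zeros i m + m + r             ∎
  where
  open ≤-Reasoning
  extra : ℕ
  extra = zeros (m * 5 + i * 5) r

-- Excess: 3z ≥ m + 3C and z' ≥ 2z + m give 3z' ≥ 5m + 6C ≥ n + 3(C+1),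
-- using r + 3 ≤ 3C, which needs C ≥ 3.
excess-step : ∀ C m r z z' → 3 ≤ C → r ≤ 4 →
  m + 3 * C ≤ 3 * z → 2 * z + m ≤ z' → (m * 5 + r) + 3 * suc C ≤ 3 * z'
excess-step C m r z z' 3≤C r≤4 excess lower = +-cancelʳ-≤ (3 * C) _ _ (begin
  (m * 5 + r) + 3 * suc C + 3 * C   ≡⟨ regroup m r C ⟩
  2 * (m + 3 * C) + 3 * m + (r + 3) ≤⟨ +-mono-≤ (+-monoˡ-≤ (3 * m) (*-monoʳ-≤ 2 excess)) r+3≤3C ⟩
  2 * (3 * z) + 3 * m + 3 * C       ≡⟨ cong (_+ 3 * C) (factor z m) ⟩
  3 * (2 * z + m) + 3 * C           ≤⟨ +-monoˡ-≤ (3 * C) (*-monoʳ-≤ 3 lower) ⟩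
  3 * z' + 3 * C                    ∎)
  where
  open ≤-Reasoning
  regroup : ∀ m r C → (m * 5 + r) + 3 * suc C + 3 * C ≡ 2 * (m + 3 * C) + 3 * m + (r + 3)
  regroup = solve-∀
  factor : ∀ z m → 2 * (3 * z) + 3 * m ≡ 3 * (2 * z + m)
  factor = solve-∀
  r+3≤3C : r + 3 ≤ 3 * C
  r+3≤3C = ≤-trans (+-monoˡ-≤ 3 r≤4) (≤-trans (≤ᵇ⇒≤ 7 9 tt) (*-monoʳ-≤ 3 3≤C))

-- Deficit: 3z + 3C ≤ m and z' ≤ 2z + m + r give 3z' + 3(C+1) ≤ n,
-- using 2r + 3 ≤ 3C, which needs C ≥ 4.
deficit-step : ∀ C m r z z' → 4 ≤ C → r ≤ 4 →
  3 * z + 3 * C ≤ m → z' ≤ 2 * z + m + r → 3 * z' + 3 * suc C ≤ m * 5 + r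
deficit-step C m r z z' 4≤C r≤4 deficit upper = +-cancelʳ-≤ (3 * C) _ _ (begin
  3 * z' + 3 * suc C + 3 * C                  ≤⟨ +-monoˡ-≤ (3 * C) (+-monoˡ-≤ (3 * suc C) (*-monoʳ-≤ 3 upper)) ⟩
  3 * (2 * z + m + r) + 3 * suc C + 3 * C     ≡⟨ regroup z m r C ⟩
  2 * (3 * z + 3 * C) + 3 * m + (r + (2 * r + 3)) ≤⟨ +-mono-≤ (+-monoˡ-≤ (3 * m) (*-monoʳ-≤ 2 deficit)) (+-monoʳ-≤ r 2r+3≤3C) ⟩
  2 * m + 3 * m + (r + 3 * C)                 ≡⟨ collect m r C ⟩
  (m * 5 + r) + 3 * C                         ∎)
  where
  open ≤-Reasoning
  regroup : ∀ z m r C → 3 * (2 * z + m + r) + 3 * suc C + 3 * C ≡ 2 * (3 * z + 3 * C) + 3 * m + (r + (2 * r + 3))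
  regroup = solve-∀
  collect : ∀ m r C → 2 * m + 3 * m + (r + 3 * C) ≡ (m * 5 + r) + 3 * C
  collect = solve-∀
  2r+3≤3C : 2 * r + 3 ≤ 3 * C
  2r+3≤3C = ≤-trans (+-monoˡ-≤ 3 (*-monoʳ-≤ 2 r≤4)) (≤-trans (≤ᵇ⇒≤ 11 12 tt) (*-monoʳ-≤ 3 4≤C))

div-mod-5 : ∀ n → n ≡ (n / 5) * 5 + n % 5
div-mod-5 n = trans (m≡m%n+[m/n]*n n 5) (+-comm (n % 5) _)

excess-lift : ∀ C n → 3 ≤ C → zM≥n/3+ (n / 5) C → zM≥n/3+ n (suc C)
excess-lift C n 3≤C (i , excess) = i * 5 ,
  subst (λ k → k + 3 * suc C ≤ 3 * zeros (i * 5) k) (sym (div-mod-5 n))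
    (excess-step C (n / 5) (n % 5) (zeros i (n / 5)) _ 3≤C (<⇒≤pred (m%n<n n 5))
      excess (zeros-σ-lower i (n / 5) (n % 5)))

deficit-lift : ∀ C n → 4 ≤ C → zm≤n/3- (n / 5) C → zm≤n/3- n (suc C)
deficit-lift C n 4≤C (i , deficit) = i * 5 ,
  subst (λ k → 3 * zeros (i * 5) k + 3 * suc C ≤ k) (sym (div-mod-5 n))
    (deficit-step C (n / 5) (n % 5) (zeros i (n / 5)) _ 4≤C (<⇒≤pred (m%n<n n 5))
      deficit (zeros-σ-upper i (n / 5) (n % 5)))

excess-weaken : ∀ n C → zM≥n/3+ n (suc C) → zM≥n/3+ n C
excess-weaken n C (i , h) = i , ≤-trans (+-monoʳ-≤ n (*-monoʳ-≤ 3 (n≤1+n C))) h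

deficit-weaken : ∀ n C → zm≤n/3- n (suc C) → zm≤n/3- n C
deficit-weaken n C (i , h) = i , ≤-trans (+-monoʳ-≤ (3 * zeros i n) (*-monoʳ-≤ 3 (n≤1+n C))) h

self-similar-induction : (P : ℕ → Set) (a : ℕ) → 0 < a →
  (∀ n → a ≤ n → n < a * 5 → P n) →
  (∀ n → a * 5 ≤ n → P (n / 5) → P n) →
  ∀ n → a ≤ n → P n
self-similar-induction P a 0<a base step = <-rec (λ n → a ≤ n → P n) go
  where
  go : ∀ n → (∀ {m} → m < n → a ≤ m → P m) → a ≤ n → P n
  go n rec a≤n with n <? a * 5
  ... | yes n<5a = base n a≤n n<5a
  ... | no  n≮5a = step n 5a≤n (rec (m/n<m n 5 {{>-nonZero 0<n}} (s≤s (s≤s z≤n))) (≤-/5 a n 5a≤n))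
    where
    5a≤n : a * 5 ≤ n
    5a≤n = ≮⇒≥ n≮5a
    0<n : 0 < n
    0<n = <-≤-trans 0<a a≤n

certifies : (ℕ → ℕ → Bool) → ℕ → List ℕ → Bool
certifies p lo []       = true
certifies p lo (i ∷ is) = p lo i ∧ certifies p (suc lo) is

certificate-sound : ∀ p lo is → T (certifies p lo is) →
  ∀ n → lo ≤ n → n < lo + length is → ∃ λ i → T (p n i)
certificate-sound p lo []       _ n lo≤n n<lo+0 =
  ⊥-elim (<⇒≱ n<lo+0 (subst (_≤ n) (sym (+-identityʳ lo)) lo≤n))
certificate-sound p lo (i ∷ is) t n lo≤n n<bound with Equivalence.to (T-∧ {p lo i}) t
... | passes , rest with m≤n⇒m<n∨m≡n lo≤n
...   | inj₂ refl = i , passes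
...   | inj₁ lo<n = certificate-sound p (suc lo) is rest n lo<n
                      (subst (n <_) (+-suc lo (length is)) n<bound)

excess-3? : ℕ → ℕ → Bool
excess-3? n i = n + 9 ≤ᵇ 3 * zeros i n

deficit-4? : ℕ → ℕ → Bool
deficit-4? n i = 3 * zeros i n + 12 ≤ᵇ n

excess-3-certificate : T (certifies excess-3? 26 (replicate 104 0))
excess-3-certificate = tt

deficit-4-witnesses : List ℕ
deficit-4-witnesses =
  219 ∷ 219 ∷ 223 ∷ 217 ∷ 219 ∷ 219 ∷ 217 ∷ 217 ∷ 217 ∷ 216 ∷ 217 ∷ 217 ∷ 213 ∷ 1111 ∷ 1111 ∷ 209 ∷
  209 ∷ 223 ∷ 207 ∷ 209 ∷ 219 ∷ 207 ∷ 217 ∷ 217 ∷ 216 ∷ 217 ∷ 217 ∷ 213 ∷ 1091 ∷ 1091 ∷ 209 ∷ 209 ∷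
  1088 ∷ 207 ∷ 209 ∷ 1084 ∷ 207 ∷ 1082 ∷ 1082 ∷ 1081 ∷ 1082 ∷ 1082 ∷ 1081 ∷ 1081 ∷ 1081 ∷ 1079 ∷ 1079 ∷ 1081 ∷
  1077 ∷ 1079 ∷ 1084 ∷ 1077 ∷ 1082 ∷ 1082 ∷ 1081 ∷ 1082 ∷ 1082 ∷ 1068 ∷ 1081 ∷ 1081 ∷ 1064 ∷ 1064 ∷ 1081 ∷ 1062 ∷
  1064 ∷ 1079 ∷ 1062 ∷ 1077 ∷ 1077 ∷ 1076 ∷ 1077 ∷ 1077 ∷ 1048 ∷ 1076 ∷ 1076 ∷ 1044 ∷ 1044 ∷ 1048 ∷ 1042 ∷ 1044 ∷
  1044 ∷ 1042 ∷ 1042 ∷ 1042 ∷ 1041 ∷ 1042 ∷ 1042 ∷ 1038 ∷ 1061 ∷ 1061 ∷ 1034 ∷ 1034 ∷ 1048 ∷ 1032 ∷ 1034 ∷ 1044 ∷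
  1032 ∷ 1042 ∷ 1042 ∷ 1041 ∷ 1042 ∷ 1042 ∷ 1038 ∷ 1041 ∷ 1041 ∷ 1034 ∷ 1034 ∷ 1038 ∷ 1032 ∷ 1034 ∷ 1034 ∷ 1032 ∷
  1032 ∷ 1032 ∷ 1031 ∷ 1032 ∷ 1032 ∷ 1031 ∷ 1031 ∷ 1031 ∷ 1029 ∷ 1029 ∷ 1031 ∷ 1027 ∷ 1029 ∷ 1034 ∷ 1027 ∷ 1032 ∷
  1032 ∷ 1031 ∷ 1032 ∷ 1032 ∷ 1031 ∷ 1031 ∷ 1031 ∷ 1029 ∷ 1029 ∷ 1031 ∷ 1027 ∷ 1029 ∷ 1079 ∷ 1027 ∷ 1077 ∷ 1077 ∷
  1076 ∷ 1077 ∷ 1077 ∷ 1048 ∷ 1076 ∷ 1076 ∷ 1044 ∷ 1044 ∷ 1048 ∷ 1042 ∷ 1044 ∷ 1044 ∷ 1042 ∷ 1042 ∷ 1042 ∷ 1041 ∷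
  1042 ∷ 1042 ∷ 1038 ∷ 1061 ∷ 1061 ∷ 1034 ∷ 1034 ∷ 1048 ∷ 1032 ∷ 1034 ∷ 1044 ∷ 1032 ∷ 1042 ∷ 1042 ∷ 1041 ∷ 1042 ∷
  1042 ∷ 1038 ∷ 1041 ∷ 1041 ∷ 1034 ∷ 1034 ∷ 1038 ∷ 1032 ∷ 1034 ∷ 1034 ∷ 1032 ∷ 1032 ∷ 1032 ∷ 1031 ∷ 1032 ∷ 1032 ∷
  1031 ∷ 1031 ∷ 1031 ∷ 1029 ∷ 1029 ∷ 1031 ∷ 1027 ∷ 1029 ∷ 1034 ∷ 1027 ∷ 1032 ∷ 1032 ∷ 1031 ∷ 1032 ∷ 1032 ∷ 1031 ∷
  1031 ∷ 1031 ∷ 1029 ∷ 1029 ∷ 1031 ∷ 1027 ∷ 1029 ∷ 1029 ∷ 1027 ∷ 1027 ∷ 1027 ∷ 1026 ∷ 1027 ∷ 1027 ∷ 1023 ∷ 1026 ∷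
  1026 ∷ 1019 ∷ 1019 ∷ 1023 ∷ 1017 ∷ 1019 ∷ 1019 ∷ 1017 ∷ 1017 ∷ 1017 ∷ 1016 ∷ 1017 ∷ 1017 ∷ 1013 ∷ 1026 ∷ 1026 ∷
  1009 ∷ 1009 ∷ 1023 ∷ 1007 ∷ 1009 ∷ 1019 ∷ 1007 ∷ 1017 ∷ 1017 ∷ 1016 ∷ 1017 ∷ 1017 ∷ 1013 ∷ 1016 ∷ 1016 ∷ 1009 ∷
  1009 ∷ 1013 ∷ 1007 ∷ 1009 ∷ 1009 ∷ 1007 ∷ 1007 ∷ 1007 ∷ 1006 ∷ 1007 ∷ 1007 ∷ 1006 ∷ 1006 ∷ 1006 ∷ 1004 ∷ 1004 ∷
  1006 ∷ 1002 ∷ 1004 ∷ 1009 ∷ 1002 ∷ 1007 ∷ 1007 ∷ 1006 ∷ 1007 ∷ 1007 ∷ 868 ∷ 1006 ∷ 1006 ∷ 864 ∷ 864 ∷ 1006 ∷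
  862 ∷ 864 ∷ 1029 ∷ 862 ∷ 1027 ∷ 1027 ∷ 1026 ∷ 1027 ∷ 1027 ∷ 848 ∷ 1026 ∷ 1026 ∷ 844 ∷ 844 ∷ 848 ∷ 842 ∷
  844 ∷ 844 ∷ 842 ∷ 842 ∷ 842 ∷ 841 ∷ 842 ∷ 842 ∷ 838 ∷ 961 ∷ 961 ∷ 834 ∷ 834 ∷ 848 ∷ 832 ∷ 834 ∷
  844 ∷ 832 ∷ 842 ∷ 842 ∷ 841 ∷ 842 ∷ 842 ∷ 838 ∷ 941 ∷ 941 ∷ 834 ∷ 834 ∷ 938 ∷ 832 ∷ 834 ∷ 934 ∷
  832 ∷ 932 ∷ 932 ∷ 931 ∷ 932 ∷ 932 ∷ 931 ∷ 931 ∷ 931 ∷ 929 ∷ 929 ∷ 931 ∷ 927 ∷ 929 ∷ 934 ∷ 927 ∷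
  932 ∷ 932 ∷ 931 ∷ 932 ∷ 932 ∷ 868 ∷ 931 ∷ 931 ∷ 864 ∷ 864 ∷ 931 ∷ 862 ∷ 864 ∷ 5879 ∷ 862 ∷ 5877 ∷
  5877 ∷ 5876 ∷ 5877 ∷ 5877 ∷ 848 ∷ 5876 ∷ 5876 ∷ 844 ∷ 844 ∷ 848 ∷ 842 ∷ 844 ∷ 844 ∷ 842 ∷ 842 ∷ 842 ∷
  841 ∷ 842 ∷ 842 ∷ 838 ∷ 861 ∷ 861 ∷ 834 ∷ 834 ∷ 848 ∷ 832 ∷ 834 ∷ 844 ∷ 832 ∷ 842 ∷ 842 ∷ 841 ∷
  842 ∷ 842 ∷ 838 ∷ 841 ∷ 841 ∷ 834 ∷ 834 ∷ 838 ∷ 832 ∷ 834 ∷ 834 ∷ 832 ∷ 832 ∷ 832 ∷ 831 ∷ 832 ∷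
  832 ∷ 831 ∷ 831 ∷ 831 ∷ 829 ∷ 829 ∷ 831 ∷ 827 ∷ 829 ∷ 834 ∷ 827 ∷ 832 ∷ 832 ∷ 831 ∷ 832 ∷ 832 ∷
  818 ∷ 831 ∷ 831 ∷ 814 ∷ 814 ∷ 831 ∷ 812 ∷ 814 ∷ 829 ∷ 812 ∷ 827 ∷ 827 ∷ 826 ∷ 827 ∷ 827 ∷ 798 ∷
  826 ∷ 826 ∷ 794 ∷ 794 ∷ 798 ∷ 792 ∷ 794 ∷ 794 ∷ 792 ∷ 792 ∷ 792 ∷ 791 ∷ 792 ∷ 792 ∷ 788 ∷ 811 ∷
  811 ∷ 784 ∷ 784 ∷ 798 ∷ 782 ∷ 784 ∷ 794 ∷ 782 ∷ 792 ∷ 792 ∷ 791 ∷ 792 ∷ 792 ∷ 788 ∷ 791 ∷ 791 ∷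
  784 ∷ 784 ∷ 788 ∷ 782 ∷ 784 ∷ 784 ∷ 782 ∷ 782 ∷ 782 ∷ 781 ∷ 782 ∷ 782 ∷ 781 ∷ 781 ∷ 781 ∷ 779 ∷
  779 ∷ 781 ∷ 777 ∷ 779 ∷ 784 ∷ 777 ∷ 782 ∷ 782 ∷ 781 ∷ 782 ∷ 782 ∷ 781 ∷ 781 ∷ 781 ∷ 779 ∷ 779 ∷
  781 ∷ 777 ∷ 779 ∷ 829 ∷ 777 ∷ 827 ∷ 827 ∷ 826 ∷ 827 ∷ 827 ∷ 798 ∷ 826 ∷ 826 ∷ 794 ∷ 794 ∷ 798 ∷
  []

deficit-4-certificate : T (certifies deficit-4? 132 deficit-4-witnesses)
deficit-4-certificate = tt

excess-3-small : ∀ n → 26 ≤ n → n < 130 → zM≥n/3+ n 3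
excess-3-small n lo≤n n<hi =
  map₂ (λ {i} → ≤ᵇ⇒≤ (n + 9) (3 * zeros i n))
       (certificate-sound excess-3? 26 (replicate 104 0) excess-3-certificate n lo≤n n<hi)

deficit-4-small : ∀ n → 132 ≤ n → n < 660 → zm≤n/3- n 4
deficit-4-small n lo≤n n<hi =
  map₂ (λ {i} → ≤ᵇ⇒≤ (3 * zeros i n + 12) n)
       (certificate-sound deficit-4? 132 deficit-4-witnesses deficit-4-certificate n lo≤n n<hi)

excess-3 : ∀ n → 26 ≤ n → zM≥n/3+ n 3
excess-3 = self-similar-induction (λ n → zM≥n/3+ n 3) 26 (s≤s z≤n) excess-3-small
  (λ n _ h → excess-weaken n 3 (excess-lift 3 n ≤-refl h))

deficit-4 : ∀ n → 132 ≤ n → zm≤n/3- n 4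
deficit-4 = self-similar-induction (λ n → zm≤n/3- n 4) 132 (s≤s z≤n) deficit-4-small
  (λ n _ h → deficit-weaken n 4 (deficit-lift 4 n ≤-refl h))

excess-4 : ∀ n → 132 ≤ n → zM≥n/3+ n 4
excess-4 n 132≤n = excess-lift 3 n ≤-refl (excess-3 (n / 5) (≤-/5 26 n (≤-trans (≤ᵇ⇒≤ 130 132 tt) 132≤n)))

bound-/5 : ∀ k n → 132 * 5 ^ suc k ≤ n → 132 * 5 ^ k ≤ n / 5
bound-/5 k n h = ≤-/5 (132 * 5 ^ k) n (subst (_≤ n) (shift (5 ^ k)) h)
  where
  shift : ∀ a → 132 * (5 * a) ≡ 132 * a * 5
  shift = solve-∀

-- Induction on k = C − 4: each factor 5 in the length buys one more unit.
excess-and-deficit : ∀ k n → 132 * 5 ^ k ≤ n → zM≥n/3+ n (4 + k) × zm≤n/3- n (4 + k)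
excess-and-deficit zero    n h = excess-4 n h , deficit-4 n h
excess-and-deficit (suc k) n h =
  map (excess-lift (4 + k) n (≤-trans (n≤1+n 3) (m≤m+n 4 k)))
      (deficit-lift (4 + k) n (m≤m+n 4 k))
      (excess-and-deficit k (n / 5) (bound-/5 k n h))

proposition6 : (C : ℕ) → 4 ≤ C → (n : ℕ) → 132 * 5 ^ (C ∸ 4) ≤ n →
    zM≥n/3+ n C × zm≤n/3- n C
proposition6 C 4≤C n h =
  subst (λ c → zM≥n/3+ n c × zm≤n/3- n c) (m+[n∸m]≡n 4≤C) (excess-and-deficit (C ∸ 4) n h)
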